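{- For integers $n\ge 0$ let $f'(n)=\#\{k\ge 1 : n+k\equiv 0 \pmod{2^k}\}$, and for $n\ge 1$ let $f(n)=\#\{k : 1\le k\le n,\ k\equiv n\pmod{2^k}\}$. Then $f'(0)=0$, $f'(1)=1$, and for all integers $i\ge 1$ and $0\le j\le 2^i-1$, $$ f'(2^i+j)=\begin{cases} f'(j)+1 & \text{if } j=2^i-i-1,\\ f'(j) & \text{otherwise}.\end{cases} $$ Moreover $f'(2^n-n)=f(n)$ for all $n\ge 1$.
   Context: The set defining $f'(n)$ is finite, since $n+k\equiv 0\pmod{2^k}$ with $n\ge 0$, $k\ge1$ forces $n+k\ge 2^k$. -}

module Defs where

open import Data.Nat using (ℕ; zero; suc; _+_; _^_; _∸_; _≤_)
open import Data.Nat.Divisibility using (_∣_; _∣?_)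
open import Data.List using (List; filter; length; map)
open import Data.List.Base using (upTo)
open import Data.Nat.Properties using (_≟_)
open import Relation.Binary.PropositionalEquality using (_≡_)

oneTo : ℕ → List ℕ
oneTo m = map suc (upTo m)

-- f'(n) = #{k ≥ 1 : 2^k ∣ n + k}.  Any such k has 2^k ≤ n + k, and 2^k ≥ 2k
-- (k ≥ 1) gives k ≤ n, so the set is {k ∈ [1, n+1] : 2^k ∣ n + k} (the bound
-- n+1 is generous) and this count is exact.
f′ : ℕ → ℕ
f′ n = length (filter (λ k → (2 ^ k) ∣? (n + k)) (oneTo (suc n)))

-- f(n) = #{k : 1 ≤ k ≤ n, k ≡ n (mod 2^k)}.  Since k ≤ n, this means 2^k ∣ n ∸ k.
f : ℕ → ℕ
f n = length (filter (λ k → (2 ^ k) ∣? (n ∸ k)) (oneTo n))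

-- An index k counts for f′ n only if 2^k ≤ n + k, so once n < 2^m only the
-- indices 1 … m matter.  For j < 2^i the number 2^i + j is below 2^(i+1): its
-- indices k ≤ i are those of j (since 2^k ∣ 2^i), and the one extra candidate
-- k = i + 1 counts iff 2^i + j + i + 1 = 2^(i+1) (the only multiple of 2^(i+1)
-- in the range of that sum), i.e. j = 2^i − i − 1.  For f′ (2^n − n), the
-- numbers (2^n − n) + k and n − k add up to 2^n, so 2^k (k ≤ n) divides one
-- iff it divides the other.

module Submission where

open import Defs
open import Data.Nat
  using (ℕ; zero; suc; _+_; _*_; _∸_; _^_; _⊔_; _≤_; _<_; z≤n; s≤s; z<s; _≤′_; ≤′-refl; ≤′-step; >-nonZero)
open import Data.Nat.Properties
open import Data.Nat.Divisibility
  using (_∣_; _∣?_; divides-refl; ∣-refl; 1∣_; *-monoʳ-∣; >⇒∤; ∣m∣n⇒∣m+n; ∣m+n∣m⇒∣n)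
open import Data.List using ([_]; _∷ʳ_; _++_; filter; length; map; upTo)
open import Data.List.Properties using (upTo-∷ʳ; map-++; filter-++; length-++; filter-accept; filter-reject)
open import Data.Product using (_×_; _,_)
open import Function.Base using (_∘_)
open import Function.Bundles using (_⇔_; mk⇔; Equivalence)
import Function.Properties.Equivalence as ⇔
open import Relation.Nullary using (¬_; yes; no; contradiction)
open import Relation.Unary using (Decidable)
open import Relation.Binary.PropositionalEquality
  using (_≡_; _≢_; refl; sym; trans; cong; subst; module ≡-Reasoning)

open Equivalence using (to; from)

countTo : {P : ℕ → Set} → Decidable P → ℕ → ℕ
countTo P? m = length (filter P? (oneTo m))

oneTo-suc : ∀ m → oneTo (suc m) ≡ oneTo m ∷ʳ suc m
oneTo-suc m = trans (cong (map suc) (sym (upTo-∷ʳ m))) (map-++ suc (upTo m) [ m ])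

module _ {P : ℕ → Set} (P? : Decidable P) where

  countTo-suc : ∀ m → countTo P? (suc m) ≡ countTo P? m + length (filter P? [ suc m ])
  countTo-suc m = begin
    length (filter P? (oneTo (suc m)))                  ≡⟨ cong (length ∘ filter P?) (oneTo-suc m) ⟩
    length (filter P? (oneTo m ∷ʳ suc m))               ≡⟨ cong length (filter-++ P? (oneTo m) [ suc m ]) ⟩
    length (filter P? (oneTo m) ++ filter P? [ suc m ]) ≡⟨ length-++ (filter P? (oneTo m)) ⟩
    countTo P? m + length (filter P? [ suc m ])         ∎
    where open ≡-Reasoning

  countTo-accept : ∀ {m} → P (suc m) → countTo P? (suc m) ≡ suc (countTo P? m)
  countTo-accept {m} p = begin
    countTo P? (suc m)                             ≡⟨ countTo-suc m ⟩
    countTo P? m + length (filter P? [ suc m ])    ≡⟨ cong (λ xs → countTo P? m + length xs) (filter-accept P? p) ⟩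
    countTo P? m + 1                               ≡⟨ +-comm (countTo P? m) 1 ⟩
    suc (countTo P? m)                             ∎
    where open ≡-Reasoning

  countTo-reject : ∀ {m} → ¬ P (suc m) → countTo P? (suc m) ≡ countTo P? m
  countTo-reject {m} ¬p = begin
    countTo P? (suc m)                             ≡⟨ countTo-suc m ⟩
    countTo P? m + length (filter P? [ suc m ])    ≡⟨ cong (λ xs → countTo P? m + length xs) (filter-reject P? ¬p) ⟩
    countTo P? m + 0                               ≡⟨ +-identityʳ (countTo P? m) ⟩
    countTo P? m                                   ∎
    where open ≡-Reasoning

  countTo-stable : ∀ {m n} → (∀ {k} → m < k → ¬ P k) → m ≤′ n → countTo P? n ≡ countTo P? m
  countTo-stable ¬P ≤′-refl = refl
  countTo-stable ¬P (≤′-step m≤′n) = trans (countTo-reject (¬P (s≤s (≤′⇒≤ m≤′n)))) (countTo-stable ¬P m≤′n)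

countTo-cong : {P Q : ℕ → Set} (P? : Decidable P) (Q? : Decidable Q) →
               ∀ m → (∀ {k} → k ≤ m → P k ⇔ Q k) → countTo P? m ≡ countTo Q? m
countTo-cong P? Q? zero P⇔Q = refl
countTo-cong P? Q? (suc m) P⇔Q with P? (suc m)
... | yes p = begin
  countTo P? (suc m)   ≡⟨ countTo-accept P? p ⟩
  suc (countTo P? m)   ≡⟨ cong suc (countTo-cong P? Q? m (λ k≤m → P⇔Q (m≤n⇒m≤1+n k≤m))) ⟩
  suc (countTo Q? m)   ≡⟨ sym (countTo-accept Q? (to (P⇔Q ≤-refl) p)) ⟩
  countTo Q? (suc m)   ∎
  where open ≡-Reasoning
... | no ¬p = begin
  countTo P? (suc m)   ≡⟨ countTo-reject P? ¬p ⟩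
  countTo P? m         ≡⟨ countTo-cong P? Q? m (λ k≤m → P⇔Q (m≤n⇒m≤1+n k≤m)) ⟩
  countTo Q? m         ≡⟨ sym (countTo-reject Q? (¬p ∘ from (P⇔Q ≤-refl))) ⟩
  countTo Q? (suc m)   ∎
  where open ≡-Reasoning

2^[1+n]≡2^n+2^n : ∀ n → 2 ^ suc n ≡ 2 ^ n + 2 ^ n
2^[1+n]≡2^n+2^n n = cong (2 ^ n +_) (+-identityʳ (2 ^ n))

n<2^n : ∀ n → n < 2 ^ n
n<2^n zero = s≤s z≤n
n<2^n (suc n) = subst (suc n <_) (sym (2^[1+n]≡2^n+2^n n)) (+-mono-≤-< (m^n>0 2 n) (n<2^n n))

^-monoʳ-∣ : ∀ m {n o} → n ≤ o → m ^ n ∣ m ^ o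
^-monoʳ-∣ m {o = o} z≤n = 1∣ (m ^ o)
^-monoʳ-∣ m (s≤s n≤o) = *-monoʳ-∣ m (^-monoʳ-∣ m n≤o)

∣m⇒[∣m+n⇔∣n] : ∀ {d m n} → d ∣ m → (d ∣ m + n ⇔ d ∣ n)
∣m⇒[∣m+n⇔∣n] d∣m = mk⇔ (λ d∣m+n → ∣m+n∣m⇒∣n d∣m+n d∣m) (∣m∣n⇒∣m+n d∣m)

∣m+n⇒[∣m⇔∣n] : ∀ {d m n} → d ∣ m + n → (d ∣ m ⇔ d ∣ n)
∣m+n⇒[∣m⇔∣n] {d} {m} {n} d∣m+n =
  mk⇔ (∣m+n∣m⇒∣n d∣m+n) (∣m+n∣m⇒∣n (subst (d ∣_) (+-comm m n) d∣m+n))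

m∣n∧0<n<m+m⇒n≡m : ∀ {m n} → m ∣ n → 0 < n → n < m + m → n ≡ m
m∣n∧0<n<m+m⇒n≡m (divides-refl zero) () _
m∣n∧0<n<m+m⇒n≡m {m} (divides-refl 1) _ _ = +-identityʳ m
m∣n∧0<n<m+m⇒n≡m {m} (divides-refl (suc (suc q))) _ n<m+m =
  contradiction n<m+m (≤⇒≯ (+-monoʳ-≤ m (m≤m+n m (q * m))))

m+m∣m+n⇔n≡m : ∀ {m n} → 0 < n → n < m + m → (m + m ∣ m + n ⇔ n ≡ m)
m+m∣m+n⇔n≡m {m} {n} 0<n n<m+m = mk⇔ to′ λ { refl → ∣-refl }
  where
  to′ : m + m ∣ m + n → n ≡ m
  to′ m+m∣m+n = +-cancelˡ-≡ m n m (m∣n∧0<n<m+m⇒n≡m m+m∣m+n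
    (<-≤-trans 0<n (m≤n+m n m)) (+-mono-≤-< (m≤m+n m m) n<m+m))

m+n≡o⇔m≡o∸n : ∀ {m n o} → n ≤ o → (m + n ≡ o ⇔ m ≡ o ∸ n)
m+n≡o⇔m≡o∸n {m} {n} n≤o = mk⇔
  (λ m+n≡o → trans (sym (m+n∸n≡m m n)) (cong (_∸ n) m+n≡o))
  (λ m≡o∸n → trans (cong (_+ n) m≡o∸n) (m∸n+n≡m n≤o))

m∸n∸1≡m∸[1+n] : ∀ m n → m ∸ n ∸ 1 ≡ m ∸ suc n
m∸n∸1≡m∸[1+n] m n = trans (∸-+-assoc m n 1) (cong (m ∸_) (+-comm n 1))

f′-index? : ∀ n → Decidable (λ k → 2 ^ k ∣ n + k)
f′-index? n k = 2 ^ k ∣? (n + k)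

f′-index-bounded : ∀ {n m k} → n < 2 ^ m → m < k → ¬ 2 ^ k ∣ n + k
f′-index-bounded {n} {m} {suc k} n<2^m (s≤s m≤k) =
  >⇒∤ {{>-nonZero (<-≤-trans z<s (m≤n+m (suc k) n))}} n+[1+k]<2^[1+k]
  where
  n+[1+k]<2^[1+k] : n + suc k < 2 ^ suc k
  n+[1+k]<2^[1+k] = subst (n + suc k <_) (sym (2^[1+n]≡2^n+2^n k))
    (+-mono-<-≤ (<-≤-trans n<2^m (^-monoʳ-≤ 2 m≤k)) (n<2^n k))

f′≡countTo : ∀ {n} m → n < 2 ^ m → f′ n ≡ countTo (f′-index? n) m
f′≡countTo {n} m n<2^m = begin
  f′ n
    ≡⟨ sym (countTo-stable (f′-index? n) (f′-index-bounded n<2^[1+n]) (≤⇒≤′ (m≤n⊔m m (suc n)))) ⟩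
  countTo (f′-index? n) (m ⊔ suc n)
    ≡⟨ countTo-stable (f′-index? n) (f′-index-bounded n<2^m) (≤⇒≤′ (m≤m⊔n m (suc n))) ⟩
  countTo (f′-index? n) m
    ∎
  where
  open ≡-Reasoning
  n<2^[1+n] : n < 2 ^ suc n
  n<2^[1+n] = <-trans (n<1+n n) (n<2^n (suc n))

f′-index-shift : ∀ {i j k} → k ≤ i → (2 ^ k ∣ (2 ^ i + j) + k ⇔ 2 ^ k ∣ j + k)
f′-index-shift {i} {j} {k} k≤i rewrite +-assoc (2 ^ i) j k = ∣m⇒[∣m+n⇔∣n] (^-monoʳ-∣ 2 k≤i)

f′-top-index : ∀ i {j} → j < 2 ^ i → (2 ^ suc i ∣ (2 ^ i + j) + suc i ⇔ j ≡ 2 ^ i ∸ i ∸ 1)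
f′-top-index i {j} j<2^i
  rewrite 2^[1+n]≡2^n+2^n i | +-assoc (2 ^ i) j (suc i) | m∸n∸1≡m∸[1+n] (2 ^ i) i =
  ⇔.trans (m+m∣m+n⇔n≡m 0<j+[1+i] (+-mono-<-≤ j<2^i (n<2^n i))) (m+n≡o⇔m≡o∸n (n<2^n i))
  where
  0<j+[1+i] : 0 < j + suc i
  0<j+[1+i] = <-≤-trans z<s (m≤n+m (suc i) j)

f′-low-indices : ∀ i {j} → j < 2 ^ i → countTo (f′-index? (2 ^ i + j)) i ≡ f′ j
f′-low-indices i {j} j<2^i = begin
  countTo (f′-index? (2 ^ i + j)) i ≡⟨ countTo-cong (f′-index? (2 ^ i + j)) (f′-index? j) i f′-index-shift ⟩
  countTo (f′-index? j) i           ≡⟨ sym (f′≡countTo i j<2^i) ⟩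
  f′ j                              ∎
  where open ≡-Reasoning

f′[2^i+j]≡countTo : ∀ i {j} → j < 2 ^ i → f′ (2 ^ i + j) ≡ countTo (f′-index? (2 ^ i + j)) (suc i)
f′[2^i+j]≡countTo i {j} j<2^i =
  f′≡countTo (suc i) (subst (2 ^ i + j <_) (sym (2^[1+n]≡2^n+2^n i)) (+-monoʳ-< (2 ^ i) j<2^i))

f′[2^n∸n]≡f : ∀ n → 1 ≤ n → f′ (2 ^ n ∸ n) ≡ f n
f′[2^n∸n]≡f n 1≤n =
  trans (f′≡countTo n M<2^n) (countTo-cong (f′-index? M) (λ k → 2 ^ k ∣? (n ∸ k)) n complementary)
  where
  M = 2 ^ n ∸ n
  M<2^n : M < 2 ^ n
  M<2^n = ∸-monoʳ-< 1≤n (<⇒≤ (n<2^n n))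
  complementary : ∀ {k} → k ≤ n → (2 ^ k ∣ M + k ⇔ 2 ^ k ∣ n ∸ k)
  complementary {k} k≤n = ∣m+n⇒[∣m⇔∣n] (subst (2 ^ k ∣_) (sym M+k+[n∸k]≡2^n) (^-monoʳ-∣ 2 k≤n))
    where
    M+k+[n∸k]≡2^n : M + k + (n ∸ k) ≡ 2 ^ n
    M+k+[n∸k]≡2^n = begin
      M + k + (n ∸ k)   ≡⟨ +-assoc M k (n ∸ k) ⟩
      M + (k + (n ∸ k)) ≡⟨ cong (M +_) (m+[n∸m]≡n k≤n) ⟩
      M + n             ≡⟨ m∸n+n≡m (<⇒≤ (n<2^n n)) ⟩
      2 ^ n             ∎
      where open ≡-Reasoning

f′[2^i+j]-critical : ∀ i j → j < 2 ^ i → j ≡ 2 ^ i ∸ i ∸ 1 → f′ (2 ^ i + j) ≡ suc (f′ j)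
f′[2^i+j]-critical i j j<2^i j≡2^i∸i∸1 = begin
  f′ (2 ^ i + j)                          ≡⟨ f′[2^i+j]≡countTo i j<2^i ⟩
  countTo (f′-index? (2 ^ i + j)) (suc i) ≡⟨ countTo-accept (f′-index? (2 ^ i + j)) top-index ⟩
  suc (countTo (f′-index? (2 ^ i + j)) i) ≡⟨ cong suc (f′-low-indices i j<2^i) ⟩
  suc (f′ j)                              ∎
  where
  open ≡-Reasoning
  top-index : 2 ^ suc i ∣ (2 ^ i + j) + suc i
  top-index = from (f′-top-index i j<2^i) j≡2^i∸i∸1

f′[2^i+j]-noncritical : ∀ i j → j < 2 ^ i → j ≢ 2 ^ i ∸ i ∸ 1 → f′ (2 ^ i + j) ≡ f′ j
f′[2^i+j]-noncritical i j j<2^i j≢2^i∸i∸1 = begin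
  f′ (2 ^ i + j)                          ≡⟨ f′[2^i+j]≡countTo i j<2^i ⟩
  countTo (f′-index? (2 ^ i + j)) (suc i) ≡⟨ countTo-reject (f′-index? (2 ^ i + j)) ¬top-index ⟩
  countTo (f′-index? (2 ^ i + j)) i       ≡⟨ f′-low-indices i j<2^i ⟩
  f′ j                                    ∎
  where
  open ≡-Reasoning
  ¬top-index : ¬ 2 ^ suc i ∣ (2 ^ i + j) + suc i
  ¬top-index = j≢2^i∸i∸1 ∘ to (f′-top-index i j<2^i)

theorem7 :
    (f′ 0 ≡ 0) × (f′ 1 ≡ 1)
    × ((i j : ℕ) → 1 ≤ i → j < 2 ^ i →
         ((j ≡ 2 ^ i ∸ i ∸ 1 → f′ (2 ^ i + j) ≡ suc (f′ j))
          × (j ≢ 2 ^ i ∸ i ∸ 1 → f′ (2 ^ i + j) ≡ f′ j)))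
    × ((n : ℕ) → 1 ≤ n → f′ (2 ^ n ∸ n) ≡ f n)
theorem7 =
  refl , refl ,
  -- the recursion holds for i = 0 as well
  (λ i j _ j<2^i → f′[2^i+j]-critical i j j<2^i , f′[2^i+j]-noncritical i j j<2^i) ,
  f′[2^n∸n]≡f
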